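{- Let $\Sigma_4=\{0,1,2,3\}$, let $f$ be the morphism $0\mapsto01$, $1\mapsto02$, $2\mapsto31$, $3\mapsto32$, and $\mathbf{u}=f^{\omega}(0)$. Let $\sigma,\sigma'$ be two total orders on $\Sigma_4$ that order the pairs $(0,3)$ and $(1,2)$ in the same way, i.e. $0<_\sigma 3$ iff $0<_{\sigma'}3$, and $1<_\sigma 2$ iff $1<_{\sigma'}2$. Then $\mathbf{l}_{d,\sigma,\mathbf{u}}=\mathbf{l}_{d,\sigma',\mathbf{u}}$ for all $d\in\Sigma_4$.
   Context: $f^{\omega}(0)=\lim_n f^n(0)$. $\mathcal{S}_{\mathbf{u}}$ is the set of infinite words over $\Sigma_4$ all of whose finite factors are factors of $\mathbf{u}$. For a total order $\sigma$ on $\Sigma_4$ (extended lexicographically) and a letter $d$ occurring in $\mathbf{u}$, $\mathbf{l}_{d,\sigma,\mathbf{u}}$ is the lexicographically least word in $\mathcal{S}_{\mathbf{u}}$ beginning with $d$. -}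

module Defs where

open import Data.Nat using (ℕ; zero; suc; _+_; _<_)
open import Data.Fin using (Fin) renaming (zero to 𝟎; suc to fs)
open import Data.List using (List; []; _∷_; concatMap; drop; head)
open import Data.Maybe using (fromMaybe)
open import Data.Product using (Σ; ∃; _×_)
open import Data.Sum using (_⊎_)
open import Relation.Binary.PropositionalEquality using (_≡_)

Σ₄ : Set
Σ₄ = Fin 4

a0 a1 a2 a3 : Σ₄
a0 = 𝟎
a1 = fs 𝟎
a2 = fs (fs 𝟎)
a3 = fs (fs (fs 𝟎))

f : Σ₄ → List Σ₄
f 𝟎                = a0 ∷ a1 ∷ []
f (fs 𝟎)           = a0 ∷ a2 ∷ []
f (fs (fs 𝟎))      = a3 ∷ a1 ∷ []
f (fs (fs (fs 𝟎))) = a3 ∷ a2 ∷ []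

fpow : ℕ → List Σ₄
fpow zero    = a0 ∷ []
fpow (suc n) = concatMap f (fpow n)

Word : Set
Word = ℕ → Σ₄

-- u = f^ω(0): the i-th letter of u is the i-th letter of f^(i+1)(0)
-- (which has length 2^(i+1) > i, and is a prefix of all later iterates;
-- the default a0 is never used).
u : Word
u i = fromMaybe a0 (head (drop i (fpow (suc i))))

InS : Word → Set
InS x = ∀ (i n : ℕ) → ∃ λ k → ∀ j → j < n → x (i + j) ≡ u (k + j)

OccursIn : Σ₄ → Set
OccursIn d = ∃ λ i → u i ≡ d

LexLt : (Σ₄ → Σ₄ → Set) → Word → Word → Set
LexLt _<σ_ x y = ∃ λ n → (∀ i → i < n → x i ≡ y i) × (x n <σ y n)

LexLe : (Σ₄ → Σ₄ → Set) → Word → Word → Set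
LexLe _<σ_ x y = (∀ i → x i ≡ y i) ⊎ LexLt _<σ_ x y

IsLexLeast : (Σ₄ → Σ₄ → Set) → Σ₄ → Word → Set
IsLexLeast _<σ_ d x =
  InS x × x 0 ≡ d × (∀ y → InS y → y 0 ≡ d → LexLe _<σ_ x y)

module Submission where

-- Split Σ₄ into the two classes {0,3} and {1,2}.  Every
-- image f(a) is a letter of {0,3} followed by a letter of {1,2}, so the
-- fixed point u alternates between the two classes, starting in {0,3}.
-- Any word x ∈ S_u inherits this: consecutive letters of x are consecutive
-- letters of u, hence lie in different classes.  Consequently two words of
-- S_u with the same first letter d lie in the same class at every position;
-- in particular, at the first position where they differ, the two letters
-- are 0,3 or 1,2 (in some order).  Two strict total orders that agree on
-- the pairs (0,3) and (1,2) therefore decide every such comparison the same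
-- way, so the lexicographic comparisons of x against the competitors y in
-- the definition of l_{d,σ,u} come out the same for σ and σ'.

open import Defs
open import Relation.Binary.PropositionalEquality
  using (_≡_; refl; sym; trans; cong; cong₂; module ≡-Reasoning)
open import Relation.Binary.Structures using (IsStrictTotalOrder)
open import Relation.Binary.Definitions using (tri<; tri≈; tri>)
open import Function.Bundles using (_⇔_; mk⇔; Equivalence)
import Function.Properties.Equivalence as ⇔
open import Data.Bool using (Bool; true; false; not)
open import Data.Nat using (ℕ; zero; suc; _+_; _<_; s≤s; z≤n)
open import Data.Nat.Properties using (+-suc; +-identityʳ; +-comm; +-mono-≤; ≤-trans; n≤1+n)
open import Data.Fin using () renaming (zero to 𝟎; suc to fs)
open import Data.List using (List; []; _∷_; concatMap; drop; head; length; _++_)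
open import Data.List.Properties using (length-++)
open import Data.Maybe using (fromMaybe)
open import Data.Product using (∃; _×_; _,_)
open import Data.Sum using (inj₁; inj₂)
open import Data.Unit using (⊤; tt)
open import Data.Empty using (⊥-elim)

kind : Σ₄ → Bool
kind 𝟎                = true
kind (fs 𝟎)           = false
kind (fs (fs 𝟎))      = false
kind (fs (fs (fs 𝟎))) = true

-- b negated k times: the class expected at position k of an alternating
-- word whose first letter has class b.
flips : Bool → ℕ → Bool
flips b zero    = b
flips b (suc k) = flips (not b) k

flips-not : ∀ b k → flips (not b) k ≡ not (flips b k)
flips-not b zero    = refl
flips-not b (suc k) = flips-not (not b) k

at : List Σ₄ → ℕ → Σ₄
at l k = fromMaybe a0 (head (drop k l))

Alternating : Bool → List Σ₄ → Set
Alternating b []      = ⊤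
Alternating b (a ∷ l) = kind a ≡ b × Alternating (not b) l

-- Each f(a) has the class pattern (true, false), so every f-image alternates.
concatMap-f-alternating : ∀ l → Alternating true (concatMap f l)
concatMap-f-alternating []                   = tt
concatMap-f-alternating (𝟎 ∷ l)              = refl , refl , concatMap-f-alternating l
concatMap-f-alternating (fs 𝟎 ∷ l)           = refl , refl , concatMap-f-alternating l
concatMap-f-alternating (fs (fs 𝟎) ∷ l)      = refl , refl , concatMap-f-alternating l
concatMap-f-alternating (fs (fs (fs 𝟎)) ∷ l) = refl , refl , concatMap-f-alternating l

alternating-at : ∀ b l k → Alternating b l → k < length l → kind (at l k) ≡ flips b k
alternating-at b (a ∷ l) zero    (ka , _)   _        = ka
alternating-at b (a ∷ l) (suc k) (_ , alt) (s≤s k<) = alternating-at (not b) l k alt k<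

length-f : ∀ a → length (f a) ≡ 2
length-f 𝟎                = refl
length-f (fs 𝟎)           = refl
length-f (fs (fs 𝟎))      = refl
length-f (fs (fs (fs 𝟎))) = refl

length-concatMap-f : ∀ l → length (concatMap f l) ≡ length l + length l
length-concatMap-f []      = refl
length-concatMap-f (a ∷ l) = begin
  length (f a ++ concatMap f l)            ≡⟨ length-++ (f a) ⟩
  length (f a) + length (concatMap f l)    ≡⟨ cong₂ _+_ (length-f a) (length-concatMap-f l) ⟩
  suc (suc (length l + length l))          ≡⟨ cong suc (sym (+-suc (length l) (length l))) ⟩
  suc (length l + suc (length l))          ∎
  where open ≡-Reasoning

-- f^n(0) is long enough to contain position n, so u n is a genuine letter of it.
length-fpow : ∀ n → n < length (fpow n)
length-fpow zero    = s≤s z≤n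
length-fpow (suc n) rewrite length-concatMap-f (fpow n) =
  +-mono-≤ (≤-trans (s≤s z≤n) (length-fpow n)) (length-fpow n)

kind-u : ∀ k → kind (u k) ≡ flips true k
kind-u k = alternating-at true (fpow (suc k)) k (concatMap-f-alternating (fpow k))
             (≤-trans (n≤1+n (suc k)) (length-fpow (suc k)))

consecutive-in-u : ∀ x → InS x → ∀ n → ∃ λ k → x n ≡ u k × x (suc n) ≡ u (suc k)
consecutive-in-u x ins n with ins n 2
... | k , occ = k , first , second
  where
  first : x n ≡ u k
  first = trans (cong x (sym (+-identityʳ n)))
            (trans (occ 0 (s≤s z≤n)) (cong u (+-identityʳ k)))
  second : x (suc n) ≡ u (suc k)
  second = trans (cong x (+-comm 1 n))
             (trans (occ 1 (s≤s (s≤s z≤n))) (cong u (+-comm k 1)))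

kind-step : ∀ x → InS x → ∀ n → kind (x (suc n)) ≡ not (kind (x n))
kind-step x ins n with consecutive-in-u x ins n
... | k , xn≡uk , xn+1≡uk+1 = begin
  kind (x (suc n))       ≡⟨ cong kind xn+1≡uk+1 ⟩
  kind (u (suc k))       ≡⟨ kind-u (suc k) ⟩
  flips (not true) k     ≡⟨ flips-not true k ⟩
  not (flips true k)     ≡⟨ cong not (sym (kind-u k)) ⟩
  not (kind (u k))       ≡⟨ cong (λ a → not (kind a)) (sym xn≡uk) ⟩
  not (kind (x n))       ∎
  where open ≡-Reasoning

kind-InS : ∀ x → InS x → ∀ n → kind (x n) ≡ flips (kind (x 0)) n
kind-InS x ins zero    = refl
kind-InS x ins (suc n) = begin
  kind (x (suc n))               ≡⟨ kind-step x ins n ⟩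
  not (kind (x n))               ≡⟨ cong not (kind-InS x ins n) ⟩
  not (flips (kind (x 0)) n)     ≡⟨ sym (flips-not (kind (x 0)) n) ⟩
  flips (not (kind (x 0))) n     ∎
  where open ≡-Reasoning

same-start-same-kind : ∀ x y → InS x → InS y → x 0 ≡ y 0 → ∀ n → kind (x n) ≡ kind (y n)
same-start-same-kind x y insx insy x0≡y0 n =
  trans (kind-InS x insx n)
        (trans (cong (λ a → flips (kind a) n) x0≡y0) (sym (kind-InS y insy n)))

-- If two strict total orders agree on whether a < b, they also agree on
-- whether b < a (both mean: a ≠ b and not a < b).
converse-agrees : ∀ {A : Set} {_<₁_ _<₂_ : A → A → Set} →
  IsStrictTotalOrder _≡_ _<₁_ → IsStrictTotalOrder _≡_ _<₂_ →
  ∀ {a b} → (a <₁ b ⇔ a <₂ b) → b <₁ a → b <₂ a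
converse-agrees S₁ S₂ {a} {b} a<b⇔ b<₁a with IsStrictTotalOrder.compare S₂ a b
... | tri< a<₂b _ _ = ⊥-elim (IsStrictTotalOrder.asym S₁ (Equivalence.from a<b⇔ a<₂b) b<₁a)
... | tri≈ _ refl _ = ⊥-elim (IsStrictTotalOrder.irrefl S₁ refl b<₁a)
... | tri> _ _ b<₂a = b<₂a

same-kind-transfer : ∀ {_<σ_ _<σ'_ : Σ₄ → Σ₄ → Set} →
  IsStrictTotalOrder _≡_ _<σ_ → IsStrictTotalOrder _≡_ _<σ'_ →
  (a0 <σ a3 ⇔ a0 <σ' a3) → (a1 <σ a2 ⇔ a1 <σ' a2) →
  ∀ a b → kind a ≡ kind b → a <σ b → a <σ' b
same-kind-transfer {_<σ_} {_<σ'_} S S' e03 e12 = transfer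
  where
  irreflexive : ∀ {a} → a <σ a → a <σ' a
  irreflexive a<a = ⊥-elim (IsStrictTotalOrder.irrefl S refl a<a)

  transfer : ∀ a b → kind a ≡ kind b → a <σ b → a <σ' b
  transfer 𝟎                𝟎                _ = irreflexive
  transfer 𝟎                (fs (fs (fs 𝟎))) _ = Equivalence.to e03
  transfer (fs (fs (fs 𝟎))) 𝟎                _ = converse-agrees S S' e03
  transfer (fs (fs (fs 𝟎))) (fs (fs (fs 𝟎))) _ = irreflexive
  transfer (fs 𝟎)           (fs 𝟎)           _ = irreflexive
  transfer (fs 𝟎)           (fs (fs 𝟎))      _ = Equivalence.to e12
  transfer (fs (fs 𝟎))      (fs 𝟎)           _ = converse-agrees S S' e12
  transfer (fs (fs 𝟎))      (fs (fs 𝟎))      _ = irreflexive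
  transfer 𝟎                (fs 𝟎)           ()
  transfer 𝟎                (fs (fs 𝟎))      ()
  transfer (fs 𝟎)           𝟎                ()
  transfer (fs 𝟎)           (fs (fs (fs 𝟎))) ()
  transfer (fs (fs 𝟎))      𝟎                ()
  transfer (fs (fs 𝟎))      (fs (fs (fs 𝟎))) ()
  transfer (fs (fs (fs 𝟎))) (fs 𝟎)           ()
  transfer (fs (fs (fs 𝟎))) (fs (fs 𝟎))      ()

LexLe-transfer : ∀ {_<σ_ _<σ'_ : Σ₄ → Σ₄ → Set} x y →
  (∀ n → x n <σ y n → x n <σ' y n) → LexLe _<σ_ x y → LexLe _<σ'_ x y
LexLe-transfer x y agree (inj₁ x≡y)             = inj₁ x≡y
LexLe-transfer x y agree (inj₂ (n , prefix , lt)) = inj₂ (n , prefix , agree n lt)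

-- Being l_{d,σ,u} transfers from σ to σ': every competitor y starts with the
-- same letter d as x, so x and y have the same class at each position.
IsLexLeast-transfer : ∀ {_<σ_ _<σ'_ : Σ₄ → Σ₄ → Set} →
  IsStrictTotalOrder _≡_ _<σ_ → IsStrictTotalOrder _≡_ _<σ'_ →
  (a0 <σ a3 ⇔ a0 <σ' a3) → (a1 <σ a2 ⇔ a1 <σ' a2) →
  ∀ d x → IsLexLeast _<σ_ d x → IsLexLeast _<σ'_ d x
IsLexLeast-transfer {_<σ_} {_<σ'_} S S' e03 e12 d x (insx , x0≡d , least) =
  insx , x0≡d , least'
  where
  least' : ∀ y → InS y → y 0 ≡ d → LexLe _<σ'_ x y
  least' y insy y0≡d =
    LexLe-transfer {_<σ_} {_<σ'_} x y
      (λ n → same-kind-transfer S S' e03 e12 (x n) (y n)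
               (same-start-same-kind x y insx insy (trans x0≡d (sym y0≡d)) n))
      (least y insy y0≡d)

mainTheorem16 : (_<σ_ _<σ'_ : Σ₄ → Σ₄ → Set) →
    IsStrictTotalOrder _≡_ _<σ_ → IsStrictTotalOrder _≡_ _<σ'_ →
    (a0 <σ a3 ⇔ a0 <σ' a3) → (a1 <σ a2 ⇔ a1 <σ' a2) →
    ∀ (d : Σ₄) → OccursIn d →
    ∀ (x : Word) → IsLexLeast _<σ_ d x ⇔ IsLexLeast _<σ'_ d x
mainTheorem16 _<σ_ _<σ'_ S S' e03 e12 d _ x =
  mk⇔ (IsLexLeast-transfer S S' e03 e12 d x)
      (IsLexLeast-transfer S' S (⇔.sym e03) (⇔.sym e12) d x)
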